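{- Let $\Omega$ be a finite ground set, $f:2^\Omega\to\mathbb{R}_{\ge0}$ a (possibly nonmonotone) submodular function, $\rho$ a routing-based cost function on $2^\Omega$ with minimum visiting cost $c_{\min}$, $\mathbf{c}>0$ a budget, and $\hat\rho$ a $(1+\theta)$-approximation algorithm for $\rho$ with $0<\theta\le c_{\min}/\mathbf{c}$. Fix $S\subseteq\Omega$. Let $X^{\rho}$ be the output of the greedy loop on $S$ with evaluator $\rho$ and budget $\mathbf{c}$, and $X^{\hat\rho}$ the output of the greedy loop on $S$ with evaluator $\hat\rho$ and budget $(1+\theta)\mathbf{c}$. Then $|X^{\hat\rho}\setminus X^{\rho}|\le 1$.
   Context: $f$ submodular: $f(A\cup B)+f(A\cap B)\le f(A)+f(B)$; $f^+_A(x)=f(A\cup\{x\})-f(A)$. Routing-based cost function: items of $\Omega$ are vertices of a weighted graph with visiting costs $c_s\ge0$ and positive edge weights, $\rho(S')=\sum_{s\in S'}c_s+r^*(S')$ with $r^*(S')$ the minimum cost of a route traversing each vertex of $S'$ at least once; $\rho(\emptyset)=0$, $\rho$ nondecreasing; $c_{\min}=\min\{c_s:s\in\Omega\}$, and $\rho(T\cup\{s\})-\rho(T)\ge c_{\min}$ for all $T\subseteq\Omega$, $s\notin T$. $\hat\rho$ satisfies $\rho(S')\le\hat\rho(S')\le(1+\theta)\rho(S')$ for all $S'$. Greedy loop on $S$ with evaluator $C$ and budget $B$: start with empty sequence $X$ and $R=S$; while $R\ne\emptyset$, let $s^*=\arg\max\{f^+_X(s):s\in R\}$ (fixed tie-breaking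 independent of $C$); if $C(X\cup\{s^*\})\le B$ append $s^*$ to $X$ and remove it from $R$, else stop; output the final $X$.
   Formalization: The functions f, ρ and $\hat\rho$ and the visiting costs $c_s$ take values in ℚ rather than ℝ, and the budget $\mathbf{c}$, θ and $c_{\min}$ are rational. -}

module Defs where

open import Data.Nat using (ℕ; zero; suc)
open import Data.Fin using (Fin)
open import Data.Fin.Subset using (Subset; ⊥; ⁅_⁆; _∪_; _∩_; _∈_; _∉_; _⊆_)
open import Data.Fin.Subset.Properties using (_∈?_)
open import Data.Fin.Properties using (_≟_)
open import Data.List using (List; []; _∷_; _++_; [_]; filter; foldr)
open import Data.List.Membership.Propositional renaming (_∈_ to _∈ˡ_)
open import Data.Rational using (ℚ; 0ℚ; _≤_; _-_)
open import Data.Rational.Properties using (_≤?_)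
open import Data.Product using (_×_; ∃)
open import Relation.Nullary using (yes; no; ¬?)
open import Relation.Binary.PropositionalEquality using (_≡_)

-- Ground set Ω = Fin n; subsets of Ω are 'Subset n'.

toSet : ∀ {n} → List (Fin n) → Subset n
toSet = foldr (λ x A → ⁅ x ⁆ ∪ A) ⊥

elems : ∀ {n} → Subset n → List (Fin n)
elems {n} S = filter (_∈? S) (Data.List.allFin n)

gain : ∀ {n} → (Subset n → ℚ) → Subset n → Fin n → ℚ
gain f A x = f (A ∪ ⁅ x ⁆) - f A

Submodular : ∀ {n} → (Subset n → ℚ) → Set
Submodular f = ∀ A B → f (A ∪ B) Data.Rational.+ f (A ∩ B) ≤ f A Data.Rational.+ f B

NonNeg : ∀ {n} → (Subset n → ℚ) → Set
NonNeg f = ∀ A → 0ℚ ≤ f A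

-- A selection rule: given the current sequence X and a nonempty remaining
-- list r ∷ rs, it returns an element of r ∷ rs. Any fixed
-- tie-breaking rule (independent of the cost evaluator) is such a function.
Selector : ℕ → Set
Selector n = List (Fin n) → Fin n → List (Fin n) → Fin n

IsArgmax : ∀ {n} → (Subset n → ℚ) → Selector n → Set
IsArgmax f sel = ∀ X r rs →
  (sel X r rs ∈ˡ (r ∷ rs)) ×
  (∀ t → t ∈ˡ (r ∷ rs) → gain f (toSet X) t ≤ gain f (toSet X) (sel X r rs))

-- The greedy loop, with a fuel argument (n steps suffice since each
-- iteration removes an element from R ⊆ Ω).
greedyAux : ∀ {n} → Selector n → (Subset n → ℚ) → ℚ → ℕ →
            List (Fin n) → List (Fin n) → List (Fin n)
greedyAux sel C B zero X R = X
greedyAux sel C B (suc k) X [] = X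
greedyAux sel C B (suc k) X (r ∷ rs) with sel X r rs
... | s with C (toSet X ∪ ⁅ s ⁆) ≤? B
...   | yes _ = greedyAux sel C B k (X ++ [ s ]) (filter (λ y → ¬? (y ≟ s)) (r ∷ rs))
...   | no  _ = X

greedy : ∀ {n} → Selector n → (Subset n → ℚ) → ℚ → Subset n → List (Fin n)
greedy {n} sel C B S = greedyAux sel C B n [] (elems S)

{-# OPTIONS --safe #-}
-- Both greedy loops query the same selector, so they pick the same items for as long as both
-- accept. If the exact loop is the first to stop, the approximate loop is already contained in
-- it. If the approximate loop accepts an item s that the exact loop rejects, then X ∪ {s} costs
-- more than the budget c, and any further item adds at least c_min ≥ θc, which the inflated
-- budget (1 + θ)c cannot absorb even under the pessimistic evaluator ρ̂ ≥ ρ; so s is the only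
-- extra item.
module Submission where

open import Defs
open import Data.Nat using (ℕ; zero; suc; z≤n) renaming (_≤_ to _≤ℕ_)
open import Data.Nat.Properties using (≤-reflexive; ≤-trans)
open import Data.Fin using (Fin)
open import Data.Fin.Subset
  using (Subset; ⊥; ⁅_⁆; _∪_; _∈_; _∉_; _⊆_; _─_; ∣_∣; inside; outside)
open import Data.Fin.Subset.Properties
  using (drop-there; ∉⊥; x∈⁅y⁆⇒x≡y; ∣⁅x⁆∣≡1; ∣⊥∣≡0; p⊆q⇒∣p∣≤∣q∣; p⊆p∪q; x∈p∪q⁻; ∪-assoc; ∪-identityˡ; ∪-identityʳ)
open import Data.Fin.Properties using (_≟_)
open import Data.Rational using (ℚ; 0ℚ; 1ℚ; _≤_; _<_; _+_; _*_)
open import Data.Rational.Properties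
  using (_≤?_; ≰⇒>; <-≤-trans; <-irrefl; *-distribʳ-+; *-identityˡ; +-mono-<-≤; module ≤-Reasoning)
open import Data.Product using (_×_; ∃; _,_; proj₁)
open import Data.Sum using (inj₁; inj₂)
open import Data.List using (List; []; _∷_; _++_; [_]; filter)
open import Data.List.Membership.Propositional using () renaming (_∈_ to _∈ˡ_)
open import Data.List.Membership.Propositional.Properties using (∈-filter⁻)
open import Data.Vec using (_∷_; here; there)
open import Data.Empty using (⊥-elim)
open import Relation.Nullary using (yes; no; ¬?)
open import Relation.Binary.PropositionalEquality using (_≡_; refl; sym; trans; cong; subst)

x∈p─q⁻ : ∀ {n} (p q : Subset n) {x : Fin n} → x ∈ p ─ q → x ∈ p × x ∉ q
x∈p─q⁻ (inside ∷ p) (outside ∷ q) here = here , λ ()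
x∈p─q⁻ (outside ∷ p) (outside ∷ q) {Fin.zero} ()
x∈p─q⁻ (outside ∷ p) (inside ∷ q) {Fin.zero} ()
x∈p─q⁻ (_ ∷ p) (_ ∷ q) (there x∈p─q) with x∈p─q⁻ p q x∈p─q
... | x∈p , x∉q = there x∈p , λ x∈q → x∉q (drop-there x∈q)

p⊆q∪r⇒∣p─q∣≤∣r∣ : ∀ {n} {p q r : Subset n} → p ⊆ q ∪ r → ∣ p ─ q ∣ ≤ℕ ∣ r ∣
p⊆q∪r⇒∣p─q∣≤∣r∣ {p = p} {q} {r} p⊆q∪r = p⊆q⇒∣p∣≤∣q∣ p─q⊆r
  where
  p─q⊆r : p ─ q ⊆ r
  p─q⊆r x∈p─q with x∈p─q⁻ p q x∈p─q
  ... | x∈p , x∉q with x∈p∪q⁻ q r (p⊆q∪r x∈p)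
  ...   | inj₁ x∈q = ⊥-elim (x∉q x∈q)
  ...   | inj₂ x∈r = x∈r

∣⊥∣≤1 : ∀ n → ∣ ⊥ {n = n} ∣ ≤ℕ 1
∣⊥∣≤1 n = subst (_≤ℕ 1) (sym (∣⊥∣≡0 n)) z≤n

toSet-∷ʳ : ∀ {n} (X : List (Fin n)) (s : Fin n) → toSet (X ++ [ s ]) ≡ toSet X ∪ ⁅ s ⁆
toSet-∷ʳ [] s = trans (∪-identityʳ ⁅ s ⁆) (sym (∪-identityˡ ⁅ s ⁆))
toSet-∷ʳ (x ∷ X) s =
  trans (cong (⁅ x ⁆ ∪_) (toSet-∷ʳ X s)) (sym (∪-assoc ⁅ x ⁆ (toSet X) ⁅ s ⁆))

⊆-toSet-∷ʳ : ∀ {n} (X : List (Fin n)) (s : Fin n) → toSet X ∪ ⁅ s ⁆ ⊆ toSet (X ++ [ s ])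
⊆-toSet-∷ʳ X s = subst (_ ∈_) (sym (toSet-∷ʳ X s))

SelectsFrom : ∀ {n} → Selector n → Set
SelectsFrom sel = ∀ X r rs → sel X r rs ∈ˡ (r ∷ rs)

Fresh : ∀ {n} → List (Fin n) → List (Fin n) → Set
Fresh X R = ∀ t → t ∈ˡ R → t ∉ toSet X

remove : ∀ {n} → Fin n → List (Fin n) → List (Fin n)
remove s = filter (λ y → ¬? (y ≟ s))

Fresh-∷ʳ : ∀ {n} (X : List (Fin n)) {R : List (Fin n)} (s : Fin n) → Fresh X R → Fresh (X ++ [ s ]) (remove s R)
Fresh-∷ʳ X {R} s fresh t t∈R-s t∈X+s with ∈-filter⁻ (λ y → ¬? (y ≟ s)) {xs = R} t∈R-s
... | t∈R , t≢s with x∈p∪q⁻ (toSet X) ⁅ s ⁆ (subst (t ∈_) (toSet-∷ʳ X s) t∈X+s)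
...   | inj₁ t∈X = fresh t t∈R t∈X
...   | inj₂ t∈s = t≢s (x∈⁅y⁆⇒x≡y s t∈s)

module _ {n} (sel : Selector n) where

  greedyAux-⊇ : ∀ C B k (X R : List (Fin n)) → toSet X ⊆ toSet (greedyAux sel C B k X R)
  greedyAux-⊇ C B zero X R = λ x∈X → x∈X
  greedyAux-⊇ C B (suc k) X [] = λ x∈X → x∈X
  greedyAux-⊇ C B (suc k) X (r ∷ rs) with sel X r rs
  ... | s with C (toSet X ∪ ⁅ s ⁆) ≤? B
  ...   | yes _ = λ x∈X → greedyAux-⊇ C B k (X ++ [ s ]) _ (⊆-toSet-∷ʳ X s (p⊆p∪q ⁅ s ⁆ x∈X))
  ...   | no _ = λ x∈X → x∈X

  module _ (sel∈ : SelectsFrom sel) where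

    greedyAux-halts : ∀ C B k (Y R : List (Fin n)) → Fresh Y R →
      (∀ s → s ∉ toSet Y → B < C (toSet Y ∪ ⁅ s ⁆)) → greedyAux sel C B k Y R ≡ Y
    greedyAux-halts C B zero Y R _ _ = refl
    greedyAux-halts C B (suc k) Y [] _ _ = refl
    greedyAux-halts C B (suc k) Y (r ∷ rs) fresh over with sel Y r rs | sel∈ Y r rs
    ... | s | s∈R with C (toSet Y ∪ ⁅ s ⁆) ≤? B
    ...   | yes within = ⊥-elim (<-irrefl refl (<-≤-trans (over s (fresh s s∈R)) within))
    ...   | no _ = refl

    greedyAux-overtakes-≤1 : ∀ C B C′ B′ →
      (∀ T s → s ∉ T → B < C T → B′ < C′ (T ∪ ⁅ s ⁆)) →
      ∀ k (X R : List (Fin n)) → Fresh X R →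
      ∃ λ E → ∣ E ∣ ≤ℕ 1 × toSet (greedyAux sel C′ B′ k X R) ⊆ toSet (greedyAux sel C B k X R) ∪ E
    greedyAux-overtakes-≤1 C B C′ B′ _ zero X R _ = ⊥ , ∣⊥∣≤1 n , p⊆p∪q ⊥
    greedyAux-overtakes-≤1 C B C′ B′ _ (suc k) X [] _ = ⊥ , ∣⊥∣≤1 n , p⊆p∪q ⊥
    greedyAux-overtakes-≤1 C B C′ B′ over (suc k) X (r ∷ rs) fresh with sel X r rs
    ... | s with C′ (toSet X ∪ ⁅ s ⁆) ≤? B′ | C (toSet X ∪ ⁅ s ⁆) ≤? B
    ...   | yes _ | yes _ =
      greedyAux-overtakes-≤1 C B C′ B′ over k (X ++ [ s ]) _ (Fresh-∷ʳ X s fresh)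
    ...   | yes _ | no rejected = ⁅ s ⁆ , ≤-reflexive (∣⁅x⁆∣≡1 s) , subst (_ ∈_) halted
      where
      halted : toSet (greedyAux sel C′ B′ k (X ++ [ s ]) (remove s (r ∷ rs))) ≡ toSet X ∪ ⁅ s ⁆
      halted = trans (cong toSet (greedyAux-halts C′ B′ k (X ++ [ s ]) _ (Fresh-∷ʳ X s fresh)
        (λ t t∉ → over _ t t∉ (subst (B <_) (cong C (sym (toSet-∷ʳ X s))) (≰⇒> rejected)))))
        (toSet-∷ʳ X s)
    ...   | no _ | yes _ =
      ⊥ , ∣⊥∣≤1 n , λ x∈X → p⊆p∪q ⊥ (greedyAux-⊇ C B k (X ++ [ s ]) _ (⊆-toSet-∷ʳ X s (p⊆p∪q ⁅ s ⁆ x∈X)))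
    ...   | no _ | no _ = ⊥ , ∣⊥∣≤1 n , p⊆p∪q ⊥

inflated-budget-overshoot : ∀ {n} (ρ ρ̂ : Subset n → ℚ) (cmin budget θ : ℚ) →
  (∀ T s → s ∉ T → ρ T + cmin ≤ ρ (T ∪ ⁅ s ⁆)) → θ * budget ≤ cmin → (∀ A → ρ A ≤ ρ̂ A) →
  ∀ T s → s ∉ T → budget < ρ T → (1ℚ + θ) * budget < ρ̂ (T ∪ ⁅ s ⁆)
inflated-budget-overshoot ρ ρ̂ cmin budget θ step θb≤cmin ρ≤ρ̂ T s s∉T budget<ρT = begin-strict
  (1ℚ + θ) * budget        ≡⟨ *-distribʳ-+ budget 1ℚ θ ⟩
  1ℚ * budget + θ * budget ≡⟨ cong (_+ θ * budget) (*-identityˡ budget) ⟩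
  budget + θ * budget      <⟨ +-mono-<-≤ budget<ρT θb≤cmin ⟩
  ρ T + cmin               ≤⟨ step T s s∉T ⟩
  ρ (T ∪ ⁅ s ⁆)            ≤⟨ ρ≤ρ̂ (T ∪ ⁅ s ⁆) ⟩
  ρ̂ (T ∪ ⁅ s ⁆)            ∎
  where open ≤-Reasoning

theorem5 : (n : ℕ) (f : Subset n → ℚ) → NonNeg f → Submodular f →
    (sel : Selector n) → IsArgmax f sel →
    (c : Fin n → ℚ) → (∀ s → 0ℚ ≤ c s) →
    (cmin : ℚ) → (∃ λ s → c s ≡ cmin) → (∀ s → cmin ≤ c s) →
    (ρ : Subset n → ℚ) → ρ ⊥ ≡ 0ℚ → (∀ A B → A ⊆ B → ρ A ≤ ρ B) →
    (∀ T s → s ∉ T → ρ T + cmin ≤ ρ (T ∪ ⁅ s ⁆)) →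
    (budget : ℚ) → 0ℚ < budget →
    (θ : ℚ) → 0ℚ < θ → θ * budget ≤ cmin →
    (ρ̂ : Subset n → ℚ) → (∀ A → ρ A ≤ ρ̂ A × ρ̂ A ≤ (1ℚ + θ) * ρ A) →
    (S : Subset n) →
    ∣ toSet (greedy sel ρ̂ ((1ℚ + θ) * budget) S) ─ toSet (greedy sel ρ budget S) ∣ ≤ℕ 1
theorem5 n _ _ _ sel argmax _ _ cmin _ _ ρ _ _ step budget _ θ _ θb≤cmin ρ̂ approx S
  with greedyAux-overtakes-≤1 sel (λ X r rs → proj₁ (argmax X r rs)) ρ budget ρ̂ ((1ℚ + θ) * budget)
         (inflated-budget-overshoot ρ ρ̂ cmin budget θ step θb≤cmin (λ A → proj₁ (approx A)))
         n [] (elems S) (λ _ _ → ∉⊥)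
... | E , ∣E∣≤1 , overtaken = ≤-trans (p⊆q∪r⇒∣p─q∣≤∣r∣ overtaken) ∣E∣≤1
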